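{- Let $n \ge 3$ and let $S$ be the set of all transpositions in the symmetric group $S_n$. Then the automorphism group of the complete transposition graph $\mathrm{Cay}(S_n,S)$ is \[ \mathrm{Aut}(\mathrm{Cay}(S_n,S)) = (R(S_n) \rtimes \mathrm{Inn}(S_n)) \rtimes \mathbb{Z}_2, \] where $\mathbb{Z}_2 = \langle h \rangle$ and $h$ is the map $\alpha \mapsto \alpha^{ -1}$ on $S_n$. Moreover, $\mathrm{Cay}(S_n,S)$ is not a normal Cayley graph.
   Context: For a group $H$ and a subset $S \subseteq H$ with $1 \notin S$ and $S = S^{ -1}$, the Cayley graph $\mathrm{Cay}(H,S)$ is the simple undirected graph with vertex set $H$ and edges $\{h, sh\}$ for $h \in H$, $s \in S$. $R(H)$ denotes the right regular representation of $H$ (the maps $x \mapsto xg$, $g \in H$), which acts as a group of graph automorphisms of $\mathrm{Cay}(H,S)$. $\mathrm{Inn}(S_n)$ is the group of inner automorphisms of $S_n$, viewed as permutations of the vertex set $S_n$. $\mathrm{Aut}(H,S)$ denotes the group of group automorphisms of $H$ fixing $S$ setwise. A Cayley graph $\mathrm{Cay}(H,S)$ is normal if $R(H)$ is a normal subgroup of $\mathrm{Aut}(\mathrm{Cay}(H,S))$, equivalently if $\mathrm{Aut}(\mathrm{Cay}(H,S)) = R(H) \rtimes \mathrm{Aut}(H,S)$. -}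

module Defs where

open import Level using (0ℓ)
open import Data.Nat using (ℕ)
open import Data.Bool using (Bool; true; false)
open import Data.Fin using (Fin)
open import Data.Product using (Σ; ∃; ∃-syntax; _×_)
open import Relation.Binary.PropositionalEquality using (_≡_; _≢_; refl; sym; trans; cong)
open import Relation.Binary.Bundles using (Setoid)
open import Data.Fin.Permutation as P using (Permutation′; _⟨$⟩ʳ_; transpose; _∘ₚ_; flip)
open import Function.Bundles using (Inverse)
open import Function.Base using (_∘_)
open import Function.Bundles using (_⇔_)

Sym : ℕ → Set
Sym n = Permutation′ n

_≈_ : ∀ {n} → Sym n → Sym n → Set
_≈_ = P._≈_

SymSetoid : ℕ → Setoid 0ℓ 0ℓ
SymSetoid n = record
  { Carrier = Sym n
  ; _≈_ = P._≈_
  ; isEquivalence = record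
    { refl = λ i → refl
    ; sym = λ p i → sym (p i)
    ; trans = λ p q i → trans (p i) (q i)
    }
  }

-- Group operations of S_n (product = composition of functions: (x · y)(i) = x (y i)).
_·_ : ∀ {n} → Sym n → Sym n → Sym n
x · y = y ∘ₚ x

_⁻¹ : ∀ {n} → Sym n → Sym n
x ⁻¹ = flip x

infixl 7 _·_
infix 8 _⁻¹
infix 4 _≈_ _≗ₛ_

IsTransposition : ∀ {n} → Sym n → Set
IsTransposition {n} s = Σ (Fin n) λ i → Σ (Fin n) λ j → i ≢ j × s ≈ transpose i j

Adj : ∀ {n} → Sym n → Sym n → Set
Adj {n} x y = Σ (Sym n) λ s → IsTransposition s × y ≈ s · x

record GraphAut (n : ℕ) : Set where
  field
    bij : Inverse (SymSetoid n) (SymSetoid n)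
    preservesAdj : ∀ x y → Adj x y ⇔ Adj (Inverse.to bij x) (Inverse.to bij y)

  to : Sym n → Sym n
  to = Inverse.to bij

  from : Sym n → Sym n
  from = Inverse.from bij

_≗ₛ_ : ∀ {n} → (Sym n → Sym n) → (Sym n → Sym n) → Set
f ≗ₛ g = ∀ x → f x ≈ g x

rightMul : ∀ {n} → Sym n → Sym n → Sym n
rightMul g x = x · g

inn : ∀ {n} → Sym n → Sym n → Sym n
inn c x = c · x · c ⁻¹

hInv : ∀ {n} → Sym n → Sym n
hInv x = x ⁻¹

hPow : ∀ {n} → Bool → Sym n → Sym n
hPow false x = x
hPow true x = hInv x

-- The element R(g) ∘ inn(c) ∘ h^ε of (R(S_n) ⋊ Inn(S_n)) ⋊ ℤ₂.
stdMap : ∀ {n} → Sym n → Sym n → Bool → Sym n → Sym n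
stdMap g c ε = rightMul g ∘ inn c ∘ hPow ε

module Submission where

-- Let φ be an automorphism of Cay(S_n, S). Composing with R(φ(e)⁻¹) we may assume
-- φ(e) = e, so φ permutes the neighbourhood S of e. Three distinct transpositions have a
-- common neighbour other than e when they form a triangle (a b), (a c), (b c), and never
-- when they form a star (a b), (a c), (a d). Hence φ maps stars to stars, and the centres
-- of the image stars define c with φ(a b) = (c a  c b). After composing with inn(c)⁻¹,
-- φ fixes e and S pointwise; it then sends a 3-cycle either to itself or to its inverse,
-- and if it fixes one 3-cycle it fixes all of them, so after composing with h if needed
-- φ fixes all 3-cycles too. This rigidity is inherited by R(t)⁻¹ φ R(t) for every
-- transposition t, and since transpositions generate S_n, φ(x) x⁻¹ = e for every x.
-- Non-normality: h R(t) h is the left translation by t, which is not a right translation.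

open import Defs
open import Data.Nat using (ℕ; suc; zero; _+_; _≥_; _≤_; _<_; z≤n; s≤s)
open import Data.Bool using (Bool; true; false)
open import Data.Product using (Σ; _×_; _,_; proj₁; proj₂)
open import Data.Sum using (_⊎_; inj₁; inj₂)
open import Data.Empty using (⊥; ⊥-elim)
open import Relation.Binary.PropositionalEquality using (_≡_; _≢_; refl; sym; trans; cong; subst; ≢-sym; module ≡-Reasoning)
open import Relation.Nullary using (¬_; yes; no; Dec)
open import Function.Base using (_∘_)
open import Level using (0ℓ)
open import Relation.Binary.Bundles using (Setoid)
import Relation.Binary.Reasoning.Setoid as SetoidReasoning
open import Function.Bundles using (Inverse; Equivalence)
open import Data.Fin using (Fin; zero; suc; punchIn; punchOut; toℕ; fromℕ<)
open import Data.Fin.Properties using (_≟_; any?; punchInᵢ≢i; punchIn-injective; punchOut-injective; injective⇒≤; toℕ<n; toℕ-fromℕ<; toℕ-injective)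
open import Data.Nat.Properties using (1+n≰n; ≤⇒≯; ≤-<-trans; _<?_; m≤n⇒m<n∨m≡n; ≤-refl)
open import Function.Definitions using (Injective)
open import Data.Fin.Permutation as P using (_⟨$⟩ʳ_; transpose)

module _ {n : ℕ} where

  e : Sym n
  e = P.id

  ap : Sym n → Fin n → Fin n
  ap x i = x ⟨$⟩ʳ i

  τ : Fin n → Fin n → Sym n
  τ = transpose

  -- _≈_ unfolds to a Π-type, from which Agda cannot recover the two
  -- permutations; wrapping it in a record makes them inferable.
  infix 4 _≋_
  record _≋_ (x y : Sym n) : Set where
    constructor mk
    field at : x ≈ y
  open _≋_ public

  ≋-refl : {x : Sym n} → x ≋ x
  ≋-refl = mk λ i → refl

  ≋-sym : {x y : Sym n} → x ≋ y → y ≋ x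
  ≋-sym p = mk λ i → sym (at p i)

  ≋-trans : {x y z : Sym n} → x ≋ y → y ≋ z → x ≋ z
  ≋-trans p q = mk λ i → trans (at p i) (at q i)

  ≋-setoid : Setoid 0ℓ 0ℓ
  ≋-setoid = record { Carrier = Sym n ; _≈_ = _≋_
                    ; isEquivalence = record { refl = ≋-refl ; sym = ≋-sym ; trans = ≋-trans } }

  module SymReasoning = SetoidReasoning ≋-setoid

  ·-cong : {x x′ y y′ : Sym n} → x ≋ x′ → y ≋ y′ → x · y ≋ x′ · y′
  ·-cong {x} {y′ = y′} p q = mk λ i → trans (cong (ap x) (at q i)) (at p (ap y′ i))

  ·-congˡ : {x x′ : Sym n} (y : Sym n) → x ≋ x′ → x · y ≋ x′ · y
  ·-congˡ y p = ·-cong p (≋-refl {y})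

  ·-congʳ : (x : Sym n) {y y′ : Sym n} → y ≋ y′ → x · y ≋ x · y′
  ·-congʳ x p = ·-cong (≋-refl {x}) p

  ·-assoc : (x y z : Sym n) → (x · y) · z ≋ x · (y · z)
  ·-assoc x y z = ≋-refl

  ·-identityʳ : (x : Sym n) → x · e ≋ x
  ·-identityʳ x = ≋-refl

  ·-inverseʳ : (x : Sym n) → x · x ⁻¹ ≋ e
  ·-inverseʳ x = mk λ i → P.inverseʳ x

  ·-inverseˡ : (x : Sym n) → x ⁻¹ · x ≋ e
  ·-inverseˡ x = mk λ i → P.inverseˡ x

  ·-cancelʳ : {x y : Sym n} (g : Sym n) → x · g ≋ y · g → x ≋ y
  ·-cancelʳ {x} {y} g p = mk λ i →
    trans (cong (ap x) (sym (P.inverseʳ g))) (trans (at p (ap (g ⁻¹) i)) (cong (ap y) (P.inverseʳ g)))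

  ·-cancelˡ : {x y : Sym n} (g : Sym n) → g · x ≋ g · y → x ≋ y
  ·-cancelˡ g p = mk λ i → trans (sym (P.inverseˡ g)) (trans (cong (ap (g ⁻¹)) (at p i)) (P.inverseˡ g))

  ⁻¹-cong : {x y : Sym n} → x ≋ y → x ⁻¹ ≋ y ⁻¹
  ⁻¹-cong {x} {y} p = ·-cancelˡ x (≋-trans (·-inverseʳ x) (≋-sym (≋-trans (·-congˡ (y ⁻¹) p) (·-inverseʳ y))))

  ap-injective : (c : Sym n) {i j : Fin n} → ap c i ≡ ap c j → i ≡ j
  ap-injective c {i} {j} q = trans (sym (P.inverseˡ c)) (trans (cong (ap (c ⁻¹)) q) (P.inverseˡ c))

  τ-mapsˡ : (i j : Fin n) → ap (τ i j) i ≡ j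
  τ-mapsˡ i j with i ≟ i
  ... | yes _ = refl
  ... | no i≢i = ⊥-elim (i≢i refl)

  τ-mapsʳ : (i j : Fin n) → ap (τ i j) j ≡ i
  τ-mapsʳ i j with j ≟ i
  ... | yes j≡i = j≡i
  ... | no _ with j ≟ j
  ...   | yes _ = refl
  ...   | no j≢j = ⊥-elim (j≢j refl)

  τ-fixes : (i j k : Fin n) → k ≢ i → k ≢ j → ap (τ i j) k ≡ k
  τ-fixes i j k k≢i k≢j with k ≟ i
  ... | yes k≡i = ⊥-elim (k≢i k≡i)
  ... | no _ with k ≟ j
  ...   | yes k≡j = ⊥-elim (k≢j k≡j)
  ...   | no _ = refl

  τ-cases : (i j k : Fin n) → (k ≡ i) ⊎ (k ≢ i × k ≡ j) ⊎ (k ≢ i × k ≢ j)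
  τ-cases i j k with k ≟ i | k ≟ j
  ... | yes k≡i | _ = inj₁ k≡i
  ... | no k≢i | yes k≡j = inj₂ (inj₁ (k≢i , k≡j))
  ... | no k≢i | no k≢j = inj₂ (inj₂ (k≢i , k≢j))

  τ-comm : (i j : Fin n) → τ i j ≋ τ j i
  τ-comm i j = mk λ k → pointwise k (τ-cases i j k)
    where
    pointwise : ∀ k → (k ≡ i) ⊎ (k ≢ i × k ≡ j) ⊎ (k ≢ i × k ≢ j) → ap (τ i j) k ≡ ap (τ j i) k
    pointwise k (inj₁ refl) = trans (τ-mapsˡ k j) (sym (τ-mapsʳ j k))
    pointwise k (inj₂ (inj₁ (_ , refl))) = trans (τ-mapsʳ i k) (sym (τ-mapsˡ k i))
    pointwise k (inj₂ (inj₂ (k≢i , k≢j))) = trans (τ-fixes i j k k≢i k≢j) (sym (τ-fixes j i k k≢j k≢i))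

  τ-involutive : (i j : Fin n) → τ i j · τ i j ≋ e
  τ-involutive i j = mk λ k → pointwise k (τ-cases i j k)
    where
    pointwise : ∀ k → (k ≡ i) ⊎ (k ≢ i × k ≡ j) ⊎ (k ≢ i × k ≢ j) → ap (τ i j) (ap (τ i j) k) ≡ k
    pointwise k (inj₁ refl) = trans (cong (ap (τ k j)) (τ-mapsˡ k j)) (τ-mapsʳ k j)
    pointwise k (inj₂ (inj₁ (_ , refl))) = trans (cong (ap (τ i k)) (τ-mapsʳ i k)) (τ-mapsˡ i k)
    pointwise k (inj₂ (inj₂ (k≢i , k≢j))) = trans (cong (ap (τ i j)) (τ-fixes i j k k≢i k≢j)) (τ-fixes i j k k≢i k≢j)

  τ-cong : {i i′ j j′ : Fin n} → i ≡ i′ → j ≡ j′ → τ i j ≋ τ i′ j′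
  τ-cong refl refl = ≋-refl

  conj-τ : (c : Sym n) (i j : Fin n) → c · τ i j · c ⁻¹ ≋ τ (ap c i) (ap c j)
  conj-τ c i j = mk λ k → subst (λ k′ → ap c (ap (τ i j) (ap (c ⁻¹) k′)) ≡ ap (τ (ap c i) (ap c j)) k′)
                                  (P.inverseʳ c) (pointwise (ap (c ⁻¹) k) (τ-cases i j (ap (c ⁻¹) k)))
    where
    c-injective : ∀ {k l} → k ≢ l → ap c k ≢ ap c l
    c-injective k≢l q = k≢l (ap-injective c q)
    pointwise : ∀ k → (k ≡ i) ⊎ (k ≢ i × k ≡ j) ⊎ (k ≢ i × k ≢ j) →
                ap c (ap (τ i j) (ap (c ⁻¹) (ap c k))) ≡ ap (τ (ap c i) (ap c j)) (ap c k)
    pointwise k cases rewrite P.inverseˡ c {k} with cases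
    ... | inj₁ refl = trans (cong (ap c) (τ-mapsˡ k j)) (sym (τ-mapsˡ (ap c k) (ap c j)))
    ... | inj₂ (inj₁ (_ , refl)) = trans (cong (ap c) (τ-mapsʳ i k)) (sym (τ-mapsʳ (ap c i) (ap c k)))
    ... | inj₂ (inj₂ (k≢i , k≢j)) = trans (cong (ap c) (τ-fixes i j k k≢i k≢j))
                                      (sym (τ-fixes _ _ (ap c k) (c-injective k≢i) (c-injective k≢j)))

  IsTransp : Sym n → Set
  IsTransp s = Σ (Fin n) λ i → Σ (Fin n) λ j → i ≢ j × s ≋ τ i j

  τ-isTransp : {i j : Fin n} → i ≢ j → IsTransp (τ i j)
  τ-isTransp {i} {j} i≢j = i , j , i≢j , ≋-refl

  IsTransp-cong : {s s′ : Sym n} → s ≋ s′ → IsTransp s → IsTransp s′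
  IsTransp-cong q (i , j , i≢j , r) = i , j , i≢j , ≋-trans (≋-sym q) r

  IsTransp-involutive : {s : Sym n} → IsTransp s → s · s ≋ e
  IsTransp-involutive (i , j , _ , r) = ≋-trans (·-cong r r) (τ-involutive i j)

  IsTransp-inverse : {s : Sym n} → IsTransp s → s ⁻¹ ≋ s
  IsTransp-inverse {s} t = ·-cancelˡ s (≋-trans (·-inverseʳ s) (≋-sym (IsTransp-involutive t)))

  IsTransp-conj : (c : Sym n) {s : Sym n} → IsTransp s → IsTransp (c · s · c ⁻¹)
  IsTransp-conj c (i , j , i≢j , r) =
    ap c i , ap c j , (λ q → i≢j (ap-injective c q)) , ≋-trans (·-congˡ (c ⁻¹) (·-congʳ c r)) (conj-τ c i j)

  record Adjacent (x y : Sym n) : Set where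
    constructor adjacent
    field
      swap : Sym n
      isTransp : IsTransp swap
      eq : y ≋ swap · x

  Adj⇒Adjacent : {x y : Sym n} → Adj x y → Adjacent x y
  Adj⇒Adjacent (s , (i , j , i≢j , r) , q) = adjacent s (i , j , i≢j , mk r) (mk q)

  Adjacent⇒Adj : {x y : Sym n} → Adjacent x y → Adj x y
  Adjacent⇒Adj (adjacent s (i , j , i≢j , r) q) = s , (i , j , i≢j , at r) , at q

  Adjacent-cong : {x x′ y y′ : Sym n} → x ≋ x′ → y ≋ y′ → Adjacent x y → Adjacent x′ y′
  Adjacent-cong p q (adjacent s t r) = adjacent s t (≋-trans (≋-sym q) (≋-trans r (·-congʳ s p)))

  Adjacent-by : {s : Sym n} (x : Sym n) → IsTransp s → Adjacent x (s · x)
  Adjacent-by {s} x t = adjacent s t ≋-refl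

  Adjacent-byʳ : {r : Sym n} (s : Sym n) → IsTransp r → Adjacent s (s · r)
  Adjacent-byʳ {r} s t = adjacent _ (IsTransp-conj s t) (mk λ i → cong (ap s) (cong (ap r) (sym (P.inverseˡ s))))

  Adjacent-e : {y : Sym n} → Adjacent e y → IsTransp y
  Adjacent-e (adjacent _ t r) = IsTransp-cong (≋-sym r) t

  Adjacent-·ʳ : {x y : Sym n} (g : Sym n) → Adjacent x y → Adjacent (x · g) (y · g)
  Adjacent-·ʳ g (adjacent s t r) = adjacent s t (·-congˡ g r)

  Adjacent-·ˡ : {x y : Sym n} (c : Sym n) → Adjacent x y → Adjacent (c · x) (c · y)
  Adjacent-·ˡ c (adjacent s t r) = adjacent _ (IsTransp-conj c t)
    (≋-trans (·-congʳ c r) (mk λ i → cong (ap c) (cong (ap s) (sym (P.inverseˡ c)))))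

  Adjacent-⁻¹ : {x y : Sym n} → Adjacent x y → Adjacent (x ⁻¹) (y ⁻¹)
  Adjacent-⁻¹ {x} (adjacent s t r) = adjacent _ (IsTransp-conj (x ⁻¹) t)
    (≋-trans (⁻¹-cong r) (≋-trans (·-congʳ (x ⁻¹) (IsTransp-inverse t))
      (mk λ i → cong (ap (x ⁻¹)) (cong (ap s) (sym (P.inverseʳ x))))))

module _ {n : ℕ} where

  open GraphAut using (to; from)

  to-cong : (φ : GraphAut n) {x y : Sym n} → x ≋ y → to φ x ≋ to φ y
  to-cong φ p = mk (Inverse.to-cong (GraphAut.bij φ) (at p))

  from-cong : (φ : GraphAut n) {x y : Sym n} → x ≋ y → from φ x ≋ from φ y
  from-cong φ p = mk (Inverse.from-cong (GraphAut.bij φ) (at p))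

  to-from : (φ : GraphAut n) (x : Sym n) → to φ (from φ x) ≋ x
  to-from φ x = mk (Inverse.inverseˡ (GraphAut.bij φ) λ i → refl)

  from-to : (φ : GraphAut n) (x : Sym n) → from φ (to φ x) ≋ x
  from-to φ x = mk (Inverse.inverseʳ (GraphAut.bij φ) λ i → refl)

  to-injective : (φ : GraphAut n) {x y : Sym n} → to φ x ≋ to φ y → x ≋ y
  to-injective φ {x} {y} p = ≋-trans (≋-sym (from-to φ x)) (≋-trans (from-cong φ p) (from-to φ y))

  to-adjacent : (φ : GraphAut n) {x y : Sym n} → Adjacent x y → Adjacent (to φ x) (to φ y)
  to-adjacent φ {x} {y} a = Adj⇒Adjacent (Equivalence.to (GraphAut.preservesAdj φ x y) (Adjacent⇒Adj a))

  to-adjacent⁻ : (φ : GraphAut n) {x y : Sym n} → Adjacent (to φ x) (to φ y) → Adjacent x y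
  to-adjacent⁻ φ {x} {y} a = Adj⇒Adjacent (Equivalence.from (GraphAut.preservesAdj φ x y) (Adjacent⇒Adj a))

  mkGraphAut : (f g : Sym n → Sym n) →
               (∀ {x y} → x ≋ y → f x ≋ f y) → (∀ {x y} → x ≋ y → g x ≋ g y) →
               (∀ x → f (g x) ≋ x) → (∀ x → g (f x) ≋ x) →
               (∀ {x y} → Adjacent x y → Adjacent (f x) (f y)) →
               (∀ {x y} → Adjacent (f x) (f y) → Adjacent x y) →
               GraphAut n
  mkGraphAut f g f-cong g-cong fg gf f-adj f-adj⁻ = record
    { bij = record
      { to = f
      ; from = g
      ; to-cong = λ p → at (f-cong (mk p))
      ; from-cong = λ p → at (g-cong (mk p))
      ; inverse = (λ {x} p → at (≋-trans (f-cong (mk p)) (fg x)))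
                , (λ {x} p → at (≋-trans (g-cong (mk p)) (gf x)))
      }
    ; preservesAdj = λ x y → record
      { to = Adjacent⇒Adj ∘ f-adj ∘ Adj⇒Adjacent
      ; from = Adjacent⇒Adj ∘ f-adj⁻ ∘ Adj⇒Adjacent
      ; to-cong = λ { refl → refl }
      ; from-cong = λ { refl → refl }
      }
    }

  infixr 9 _∘ᴬ_
  _∘ᴬ_ : GraphAut n → GraphAut n → GraphAut n
  ψ ∘ᴬ φ = mkGraphAut (to ψ ∘ to φ) (from φ ∘ from ψ)
    (to-cong ψ ∘ to-cong φ) (from-cong φ ∘ from-cong ψ)
    (λ x → ≋-trans (to-cong ψ (to-from φ (from ψ x))) (to-from ψ x))
    (λ x → ≋-trans (from-cong φ (from-to ψ (to φ x))) (from-to φ x))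
    (to-adjacent ψ ∘ to-adjacent φ) (to-adjacent⁻ φ ∘ to-adjacent⁻ ψ)

  idAut : GraphAut n
  idAut = mkGraphAut (λ x → x) (λ x → x) (λ p → p) (λ p → p) (λ x → ≋-refl) (λ x → ≋-refl) (λ a → a) (λ a → a)

  rightMulAut : Sym n → GraphAut n
  rightMulAut g = mkGraphAut (rightMul g) (rightMul (g ⁻¹)) (·-congˡ g) (·-congˡ (g ⁻¹))
    (λ x → mk λ i → cong (ap x) (P.inverseˡ g)) (λ x → mk λ i → cong (ap x) (P.inverseʳ g))
    (Adjacent-·ʳ g)
    (λ {x} {y} a → Adjacent-cong (mk λ i → cong (ap x) (P.inverseʳ g)) (mk λ i → cong (ap y) (P.inverseʳ g))
                                 (Adjacent-·ʳ (g ⁻¹) a))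

  leftMulAut : Sym n → GraphAut n
  leftMulAut c = mkGraphAut (c ·_) (c ⁻¹ ·_) (·-congʳ c) (·-congʳ (c ⁻¹))
    (λ x → mk λ i → P.inverseʳ c) (λ x → mk λ i → P.inverseˡ c)
    (Adjacent-·ˡ c)
    (λ a → Adjacent-cong (mk λ i → P.inverseˡ c) (mk λ i → P.inverseˡ c) (Adjacent-·ˡ (c ⁻¹) a))

  hInvAut : GraphAut n
  hInvAut = mkGraphAut hInv hInv ⁻¹-cong ⁻¹-cong (λ x → ≋-refl) (λ x → ≋-refl) Adjacent-⁻¹ Adjacent-⁻¹

  hPowAut : Bool → GraphAut n
  hPowAut false = idAut
  hPowAut true = hInvAut

  innAut : Sym n → GraphAut n
  innAut c = rightMulAut (c ⁻¹) ∘ᴬ leftMulAut c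

  stdAut : Sym n → Sym n → Bool → GraphAut n
  stdAut g c ε = rightMulAut g ∘ᴬ innAut c ∘ᴬ hPowAut ε

  stdAut-to : (g c : Sym n) (ε : Bool) → to (stdAut g c ε) ≗ₛ stdMap g c ε
  stdAut-to g c false x i = refl
  stdAut-to g c true x i = refl

  conjR : GraphAut n → Sym n → GraphAut n
  conjR φ g = rightMulAut (g ⁻¹) ∘ᴬ φ ∘ᴬ rightMulAut g

  conjR-fixes : (θ : GraphAut n) (g u : Sym n) → to θ (u · g) ≋ u · g → to (conjR θ g) u ≋ u
  conjR-fixes θ g u fixed = ≋-trans (·-congˡ (g ⁻¹) fixed) (mk λ i → cong (ap u) (P.inverseʳ g))

  conjR-∘ : (θ : GraphAut n) (x t u : Sym n) → to (conjR (conjR θ x) t) u ≋ to (conjR θ (t · x)) u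
  conjR-∘ θ x t u = mk λ i → at (to-cong θ (·-assoc u t x)) (ap (x ⁻¹) (ap (t ⁻¹) i))

  conjR-cong : (θ : GraphAut n) {x x′ : Sym n} → x ≋ x′ → ∀ u → to (conjR θ x) u ≋ to (conjR θ x′) u
  conjR-cong θ {x} {x′} p u = ·-cong (to-cong θ (·-congʳ u p)) (⁻¹-cong p)

  conjR-e : (θ : GraphAut n) (u : Sym n) → to (conjR θ e) u ≋ to θ u
  conjR-e θ u = to-cong θ (·-identityʳ u)

module _ {n : ℕ} where

  inn-homo : (c x y : Sym n) → inn c (x · y) ≋ inn c x · inn c y
  inn-homo c x y = mk λ i → cong (ap c) (cong (ap x) (sym (P.inverseˡ c)))

  inn-cong : (c : Sym n) {x y : Sym n} → x ≋ y → inn c x ≋ inn c y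
  inn-cong c p = ·-congˡ (c ⁻¹) (·-congʳ c p)

  inn-injective : (c : Sym n) {x y : Sym n} → inn c x ≋ inn c y → x ≋ y
  inn-injective c p = ·-cancelˡ c (·-cancelʳ (c ⁻¹) p)

  -- inn c is a homomorphism and inn c′ ∘ hInv an anti-homomorphism.
  inn≋inn∘hInv⇒comm : (c c′ : Sym n) → (∀ x → inn c x ≋ inn c′ (x ⁻¹)) → (x y : Sym n) → x · y ≋ y · x
  inn≋inn∘hInv⇒comm c c′ H x y = inn-injective c (begin
    inn c (x · y)                 ≈⟨ inn-homo c x y ⟩
    inn c x · inn c y             ≈⟨ ·-cong (H x) (H y) ⟩
    inn c′ (x ⁻¹) · inn c′ (y ⁻¹) ≈⟨ ≋-sym (inn-homo c′ (x ⁻¹) (y ⁻¹)) ⟩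
    inn c′ ((y · x) ⁻¹)           ≈⟨ ≋-sym (H (y · x)) ⟩
    inn c (y · x)                 ∎)
    where open SymReasoning

  stdMap-solve : (c g y x : Sym n) → inn (c ⁻¹) (y · g ⁻¹) ≋ x → y ≋ stdMap g c false x
  stdMap-solve c g y x p = mk λ i →
    trans (sym (cong (ap y) (P.inverseˡ g)))
    (trans (cong (λ z → ap y (ap (g ⁻¹) z)) (sym (P.inverseʳ c)))
    (trans (sym (P.inverseʳ c)) (cong (ap c) (at p (ap (c ⁻¹) (ap g i))))))

  stdMap-e : (g c : Sym n) (ε : Bool) → stdMap g c ε e ≋ g
  stdMap-e g c false = mk λ i → P.inverseʳ c
  stdMap-e g c true = mk λ i → P.inverseʳ c

  inn-normalises-R : (c g : Sym n) → (inn c ∘ rightMul g ∘ inn (c ⁻¹)) ≗ₛ rightMul (inn c g)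
  inn-normalises-R c g x i = P.inverseʳ c

  hInv-normalises-RInn : (g c : Sym n) → (hInv ∘ stdMap g c false ∘ hInv) ≗ₛ stdMap (g ⁻¹) (g ⁻¹ · c) false
  hInv-normalises-RInn g c x i = cong (ap (g ⁻¹ · c · x)) (cong (ap (c ⁻¹)) (sym (P.inverseʳ g)))

module _ {k : ℕ} where

  private
    0F 1F 2F : Fin (3 + k)
    0F = zero
    1F = suc zero
    2F = suc (suc zero)

  Sym-nonabelian : ¬ (τ 0F 1F · τ 0F 2F ≋ τ 0F 2F · τ 0F 1F)
  Sym-nonabelian p with at p 0F
  ... | ()

  stdMap-unique : (g c g′ c′ : Sym (3 + k)) (ε ε′ : Bool) → stdMap g c ε ≗ₛ stdMap g′ c′ ε′ →
                  (g ≈ g′) × (inn c ≗ₛ inn c′) × (ε ≡ ε′)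
  stdMap-unique g c g′ c′ ε ε′ H = at g≋g′ , inn-unique ε ε′ inn-eq
    where
    g≋g′ : g ≋ g′
    g≋g′ = ≋-trans (≋-sym (stdMap-e g c ε)) (≋-trans (mk (H e)) (stdMap-e g′ c′ ε′))
    inn-eq : ∀ x → inn c (hPow ε x) ≋ inn c′ (hPow ε′ x)
    inn-eq x = ·-cancelʳ g (≋-trans (mk (H x)) (·-congʳ (inn c′ (hPow ε′ x)) (≋-sym g≋g′)))
    inn-unique : (ε ε′ : Bool) → (∀ x → inn c (hPow ε x) ≋ inn c′ (hPow ε′ x)) → (inn c ≗ₛ inn c′) × (ε ≡ ε′)
    inn-unique false false K = (λ x → at (K x)) , refl
    inn-unique true true K = (λ x → at (K (x ⁻¹))) , refl
    inn-unique false true K = ⊥-elim (Sym-nonabelian (inn≋inn∘hInv⇒comm c c′ K (τ 0F 1F) (τ 0F 2F)))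
    inn-unique true false K = ⊥-elim (Sym-nonabelian (inn≋inn∘hInv⇒comm c′ c (λ x → ≋-sym (K x)) (τ 0F 1F) (τ 0F 2F)))

  R-not-normal : ¬ ((φ : GraphAut (3 + k)) (g : Sym (3 + k)) → Σ (Sym (3 + k)) λ g′ →
                   (GraphAut.to φ ∘ rightMul g ∘ GraphAut.from φ) ≗ₛ rightMul g′)
  R-not-normal H with H hInvAut (τ 0F 1F)
  ... | g′ , K = 2≢1 (begin
    2F                         ≡⟨ K (τ 0F 2F) 0F ⟩
    ap (τ 0F 2F) (ap g′ 0F)    ≡⟨ cong (ap (τ 0F 2F)) (sym (K e 0F)) ⟩
    ap (τ 0F 2F) 1F            ≡⟨ τ-fixes 0F 2F 1F (λ ()) (λ ()) ⟩
    1F                         ∎)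
    where
    open ≡-Reasoning
    2≢1 : 2F ≢ 1F
    2≢1 ()

module _ {n : ℕ} where

  Moves : Sym n → Fin n → Set
  Moves s x = ap s x ≢ x

  Moves-cong : {s s′ : Sym n} {x : Fin n} → s ≋ s′ → Moves s x → Moves s′ x
  Moves-cong p m r = m (trans (at p _) r)

  τ-movesˡ : (i j : Fin n) → i ≢ j → Moves (τ i j) i
  τ-movesˡ i j i≢j r = i≢j (trans (sym r) (τ-mapsˡ i j))

  τ-movesʳ : (i j : Fin n) → i ≢ j → Moves (τ i j) j
  τ-movesʳ i j i≢j r = i≢j (trans (sym (τ-mapsʳ i j)) r)

  τ-moves⇒endpoint : (i j x : Fin n) → Moves (τ i j) x → x ≡ i ⊎ x ≡ j
  τ-moves⇒endpoint i j x m with τ-cases i j x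
  ... | inj₁ x≡i = inj₁ x≡i
  ... | inj₂ (inj₁ (_ , x≡j)) = inj₂ x≡j
  ... | inj₂ (inj₂ (x≢i , x≢j)) = ⊥-elim (m (τ-fixes i j x x≢i x≢j))

  τ·τ-moves⇒endpoint : (a b c d x : Fin n) → Moves (τ c d · τ a b) x → (x ≡ a ⊎ x ≡ b) ⊎ (x ≡ c ⊎ x ≡ d)
  τ·τ-moves⇒endpoint a b c d x m with τ-cases a b x
  ... | inj₁ x≡a = inj₁ (inj₁ x≡a)
  ... | inj₂ (inj₁ (_ , x≡b)) = inj₁ (inj₂ x≡b)
  ... | inj₂ (inj₂ (x≢a , x≢b)) =
    inj₂ (τ-moves⇒endpoint c d x λ r → m (trans (cong (ap (τ c d)) (τ-fixes a b x x≢a x≢b)) r))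

  τ-endpoints : (a b i j : Fin n) → i ≢ j → i ≡ a ⊎ i ≡ b → j ≡ a ⊎ j ≡ b → τ i j ≋ τ a b
  τ-endpoints a b i j i≢j (inj₁ refl) (inj₁ refl) = ⊥-elim (i≢j refl)
  τ-endpoints a b i j i≢j (inj₁ refl) (inj₂ refl) = ≋-refl
  τ-endpoints a b i j i≢j (inj₂ refl) (inj₁ refl) = τ-comm b a
  τ-endpoints a b i j i≢j (inj₂ refl) (inj₂ refl) = ⊥-elim (i≢j refl)

  τ-through-endpoint : (a b i : Fin n) → a ≢ b → i ≡ a ⊎ i ≡ b → Σ (Fin n) λ b′ → i ≢ b′ × τ a b ≋ τ i b′
  τ-through-endpoint a b i a≢b (inj₁ refl) = b , a≢b , ≋-refl
  τ-through-endpoint a b i a≢b (inj₂ refl) = a , ≢-sym a≢b , τ-comm a b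

  IsTransp-moves : {s : Sym n} {x : Fin n} → IsTransp s → Moves s x → s ≋ τ x (ap s x)
  IsTransp-moves {s} {x} (i , j , i≢j , r) m with τ-moves⇒endpoint i j x (Moves-cong r m)
  ... | inj₁ refl = ≋-trans r (τ-cong refl (trans (sym (τ-mapsˡ x j)) (sym (at r x))))
  ... | inj₂ refl = ≋-trans r (≋-trans (τ-comm i x) (τ-cong refl (trans (sym (τ-mapsʳ i x)) (sym (at r x)))))

  IsTransp-on : {s : Sym n} {u v : Fin n} → IsTransp s → Moves s u → Moves s v → u ≢ v → s ≋ τ u v
  IsTransp-on (i , j , i≢j , r) mu mv u≢v =
    ≋-trans r (≋-sym (τ-endpoints i j _ _ u≢v (τ-moves⇒endpoint i j _ (Moves-cong r mu))
                                              (τ-moves⇒endpoint i j _ (Moves-cong r mv))))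

  IsTransp-undo : {p q : Sym n} {x : Fin n} → IsTransp p → IsTransp q → Moves p x → ap q (ap p x) ≡ x → q ≋ p
  IsTransp-undo {p} {q} {x} tp tq m qpx =
    ≋-trans (IsTransp-moves tq (λ r → m (sym (trans (sym qpx) r))))
            (≋-trans (τ-cong refl qpx) (≋-trans (τ-comm (ap p x) x) (≋-sym (IsTransp-moves tp m))))

  Moves-· : {p q : Sym n} {x : Fin n} → IsTransp p → IsTransp q → ¬ (q · p ≋ e) → Moves p x → Moves (q · p) x
  Moves-· {p} tp tq qp≉e m fixed = qp≉e (≋-trans (·-congˡ p (IsTransp-undo tp tq m fixed)) (IsTransp-involutive tp))

  ·-IsTransp-≉e : {s t : Sym n} → IsTransp s → ¬ (s ≋ t) → ¬ (t · s ≋ e)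
  ·-IsTransp-≉e {s} {t} ts s≉t ts≋e =
    s≉t (≋-sym (≋-trans (≋-sym (·-congʳ t (IsTransp-involutive ts))) (·-congˡ s ts≋e)))

  private
    Factor : Sym n → Sym n → Sym n → Set
    Factor s t p = p ≋ s ⊎ p ≋ t ⊎ p ≋ s · t · s

    -- On four distinct points, q = t s p would satisfy q (q i) = j.
    τ-cross-distinct : {q : Sym n} (i b j d : Fin n) → i ≢ b → i ≢ j → i ≢ d → b ≢ j → b ≢ d → j ≢ d →
                       IsTransp q → q · τ i j ≋ τ j d · τ i b → ⊥
    τ-cross-distinct {q} i b j d i≢b i≢j i≢d b≢j b≢d j≢d tq eq = i≢j (sym (begin
      j             ≡⟨ sym (trans (at q≋tsp d) qd) ⟩
      ap q d        ≡⟨ cong (ap q) (sym (trans (at q≋tsp i) qi)) ⟩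
      ap q (ap q i) ≡⟨ at (IsTransp-involutive tq) i ⟩
      i             ∎))
      where
      open ≡-Reasoning
      q≋tsp : q ≋ τ j d · τ i b · τ i j
      q≋tsp = ·-cancelʳ (τ i j) (≋-trans eq (≋-sym (·-congʳ (τ j d · τ i b) (τ-involutive i j))))
      qi : ap (τ j d) (ap (τ i b) (ap (τ i j) i)) ≡ d
      qi = trans (cong (ap (τ j d)) (trans (cong (ap (τ i b)) (τ-mapsˡ i j))
                                           (τ-fixes i b j (≢-sym i≢j) (≢-sym b≢j))))
                 (τ-mapsˡ j d)
      qd : ap (τ j d) (ap (τ i b) (ap (τ i j) d)) ≡ j
      qd = trans (cong (ap (τ j d)) (trans (cong (ap (τ i b)) (τ-fixes i j d (≢-sym i≢d) (≢-sym j≢d)))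
                                           (τ-fixes i b d (≢-sym i≢d) (≢-sym b≢d))))
                 (τ-mapsʳ j d)

    τ-cross : {q : Sym n} (i b j d : Fin n) → i ≢ b → j ≢ d → i ≢ j → IsTransp q →
              q · τ i j ≋ τ j d · τ i b → Factor (τ i b) (τ j d) (τ i j)
    τ-cross i b j d i≢b j≢d i≢j tq eq with b ≟ j | d ≟ i | b ≟ d
    ... | yes refl | _ | _ = inj₁ ≋-refl
    ... | no _ | yes refl | _ = inj₂ (inj₁ (τ-comm d j))
    ... | no b≢j | no d≢i | yes refl = inj₂ (inj₂ (≋-sym (begin
      τ i b · τ j b · τ i b           ≈⟨ ·-congʳ (τ i b · τ j b) (≋-sym (IsTransp-inverse (τ-isTransp i≢b))) ⟩
      τ i b · τ j b · τ i b ⁻¹        ≈⟨ conj-τ (τ i b) j b ⟩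
      τ (ap (τ i b) j) (ap (τ i b) b) ≈⟨ τ-cong (τ-fixes i b j (≢-sym i≢j) (≢-sym b≢j)) (τ-mapsʳ i b) ⟩
      τ j i                           ≈⟨ τ-comm j i ⟩
      τ i j                           ∎)))
      where open SymReasoning
    ... | no b≢j | no d≢i | no b≢d = ⊥-elim (τ-cross-distinct i b j d i≢b i≢j (≢-sym d≢i) b≢j b≢d j≢d tq eq)

  -- Every point moved by p is moved by q p = t s, so p lives on the points of s and t.
  IsTransp-factor : {s t p q : Sym n} → IsTransp s → IsTransp t → ¬ (s ≋ t) → IsTransp p → IsTransp q →
                    q · p ≋ t · s → p ≋ s ⊎ p ≋ t ⊎ p ≋ s · t · s
  IsTransp-factor {s} {t} {p} {q} ts@(a , b , a≢b , s≋) tt@(c , d , c≢d , t≋) s≉t tp@(i , j , i≢j , p≋) tq eq =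
    factor (endpoint i (Moves-cong (≋-sym p≋) (τ-movesˡ i j i≢j)))
           (endpoint j (Moves-cong (≋-sym p≋) (τ-movesʳ i j i≢j)))
    where
    endpoint : (x : Fin n) → Moves p x → (x ≡ a ⊎ x ≡ b) ⊎ (x ≡ c ⊎ x ≡ d)
    endpoint x m = τ·τ-moves⇒endpoint a b c d x
      (Moves-cong (·-cong t≋ s≋) (Moves-cong eq (Moves-· tp tq (λ r → ·-IsTransp-≉e ts s≉t (≋-trans (≋-sym eq) r)) m)))
    transport : ∀ {s′ t′ p′} → s ≋ s′ → t ≋ t′ → p ≋ p′ → Factor s′ t′ p′ → Factor s t p
    transport s≋s′ t≋t′ p≋p′ (inj₁ r) = inj₁ (≋-trans p≋p′ (≋-trans r (≋-sym s≋s′)))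
    transport s≋s′ t≋t′ p≋p′ (inj₂ (inj₁ r)) = inj₂ (inj₁ (≋-trans p≋p′ (≋-trans r (≋-sym t≋t′))))
    transport s≋s′ t≋t′ p≋p′ (inj₂ (inj₂ r)) =
      inj₂ (inj₂ (≋-trans p≋p′ (≋-trans r (≋-sym (·-cong (·-cong s≋s′ t≋t′) s≋s′)))))
    factor : (i ≡ a ⊎ i ≡ b) ⊎ (i ≡ c ⊎ i ≡ d) → (j ≡ a ⊎ j ≡ b) ⊎ (j ≡ c ⊎ j ≡ d) → Factor s t p
    factor (inj₁ ia) (inj₁ ja) = inj₁ (≋-trans p≋ (≋-trans (τ-endpoints a b i j i≢j ia ja) (≋-sym s≋)))
    factor (inj₂ ic) (inj₂ jc) = inj₂ (inj₁ (≋-trans p≋ (≋-trans (τ-endpoints c d i j i≢j ic jc) (≋-sym t≋))))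
    factor (inj₁ ia) (inj₂ jc) with τ-through-endpoint a b i a≢b ia | τ-through-endpoint c d j c≢d jc
    ... | b′ , i≢b′ , s′ | d′ , j≢d′ , t′ =
      transport (≋-trans s≋ s′) (≋-trans t≋ t′) p≋
        (τ-cross i b′ j d′ i≢b′ j≢d′ i≢j tq
          (≋-trans (·-congʳ q (≋-sym p≋)) (≋-trans eq (·-cong (≋-trans t≋ t′) (≋-trans s≋ s′)))))
    factor (inj₂ ic) (inj₁ ja) with τ-through-endpoint a b j a≢b ja | τ-through-endpoint c d i c≢d ic
    ... | b′ , j≢b′ , s′ | d′ , i≢d′ , t′ =
      transport (≋-trans s≋ s′) (≋-trans t≋ t′) (≋-trans p≋ (τ-comm i j))
        (τ-cross j b′ i d′ j≢b′ i≢d′ (≢-sym i≢j) tq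
          (≋-trans (·-congʳ q (≋-sym (≋-trans p≋ (τ-comm i j)))) (≋-trans eq (·-cong (≋-trans t≋ t′) (≋-trans s≋ s′)))))

  common-neighbours : {s t u : Sym n} → IsTransp s → IsTransp t → ¬ (s ≋ t) → Adjacent s u → Adjacent t u →
                      u ≋ e ⊎ u ≋ s · t ⊎ u ≋ t · s
  common-neighbours {s} {t} {u} ts tt s≉t (adjacent p tp u≋ps) (adjacent q tq u≋qt) =
    classify (IsTransp-factor ts tt s≉t tp tq qp≋ts)
    where
    qp≋ts : q · p ≋ t · s
    qp≋ts = ·-cancelʳ s (≋-trans (·-congʳ q (≋-trans (≋-sym u≋ps) u≋qt))
              (≋-trans (·-congˡ t (IsTransp-involutive tq)) (≋-sym (·-congʳ t (IsTransp-involutive ts)))))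
    classify : p ≋ s ⊎ p ≋ t ⊎ p ≋ s · t · s → u ≋ e ⊎ u ≋ s · t ⊎ u ≋ t · s
    classify (inj₁ r) = inj₁ (≋-trans u≋ps (≋-trans (·-congˡ s r) (IsTransp-involutive ts)))
    classify (inj₂ (inj₁ r)) = inj₂ (inj₂ (≋-trans u≋ps (·-congˡ s r)))
    classify (inj₂ (inj₂ r)) = inj₂ (inj₁ (≋-trans u≋ps (≋-trans (·-congˡ s r) (·-congʳ (s · t) (IsTransp-involutive ts)))))

  Distinct₃ : Fin n → Fin n → Fin n → Set
  Distinct₃ a b c = a ≢ b × a ≢ c × b ≢ c

  Distinct₃-swap : {a b c : Fin n} → Distinct₃ a b c → Distinct₃ a c b
  Distinct₃-swap (a≢b , a≢c , b≢c) = a≢c , a≢b , ≢-sym b≢c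

  Distinct₃-rotate : {a b c : Fin n} → Distinct₃ a b c → Distinct₃ b c a
  Distinct₃-rotate (a≢b , a≢c , b≢c) = b≢c , ≢-sym a≢b , ≢-sym a≢c

  ShareMoved : Sym n → Sym n → Set
  ShareMoved s t = Σ (Fin n) λ x → Moves s x × Moves t x

  Overlapping : Sym n → Sym n → Set
  Overlapping s t = Σ (Fin n) λ x → Σ (Fin n) λ y → Σ (Fin n) λ z →
    Distinct₃ x y z × s ≋ τ x y × t ≋ τ x z

  Disjoint : Sym n → Sym n → Set
  Disjoint s t = Σ (Fin n) λ a → Σ (Fin n) λ b → Σ (Fin n) λ c → Σ (Fin n) λ d →
    a ≢ b × c ≢ d × a ≢ c × a ≢ d × b ≢ c × b ≢ d × s ≋ τ a b × t ≋ τ c d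

  IsTransp-pair : {s t : Sym n} → IsTransp s → IsTransp t → s ≋ t ⊎ Overlapping s t ⊎ Disjoint s t
  IsTransp-pair (a , b , a≢b , s≋) (c , d , c≢d , t≋) with a ≟ c | a ≟ d | b ≟ c | b ≟ d
  ... | yes refl | _ | _ | yes refl = inj₁ (≋-trans s≋ (≋-sym t≋))
  ... | yes refl | _ | _ | no b≢d = inj₂ (inj₁ (a , b , d , (a≢b , c≢d , b≢d) , s≋ , t≋))
  ... | no _ | yes refl | yes refl | _ = inj₁ (≋-trans s≋ (≋-trans (τ-comm a b) (≋-sym t≋)))
  ... | no a≢c | yes refl | no b≢c | _ = inj₂ (inj₁ (a , b , c , (a≢b , a≢c , b≢c) , s≋ , ≋-trans t≋ (τ-comm c a)))
  ... | no _ | no a≢d | yes refl | _ = inj₂ (inj₁ (b , a , d , (≢-sym a≢b , c≢d , a≢d) , ≋-trans s≋ (τ-comm a b) , t≋))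
  ... | no a≢c | no _ | no b≢c | yes refl =
    inj₂ (inj₁ (b , a , c , (≢-sym a≢b , b≢c , a≢c) , ≋-trans s≋ (τ-comm a b) , ≋-trans t≋ (τ-comm c b)))
  ... | no a≢c | no a≢d | no b≢c | no b≢d = inj₂ (inj₂ (a , b , c , d , a≢b , c≢d , a≢c , a≢d , b≢c , b≢d , s≋ , t≋))

  τ-≉ : (a b c d : Fin n) → a ≢ b → a ≢ c → a ≢ d → ¬ (τ a b ≋ τ c d)
  τ-≉ a b c d a≢b a≢c a≢d p = a≢b (sym (trans (sym (τ-mapsˡ a b)) (trans (at p a) (τ-fixes c d a a≢c a≢d))))

  τ-≉-shared : (a b c : Fin n) → Distinct₃ a b c → ¬ (τ a b ≋ τ a c)
  τ-≉-shared a b c (a≢b , _ , b≢c) p = τ-≉ b a a c (≢-sym a≢b) (≢-sym a≢b) b≢c (≋-trans (τ-comm b a) p)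

  triangle-≉ : (a b c : Fin n) → Distinct₃ a b c → ¬ (τ a b ≋ τ a c) × ¬ (τ b c ≋ τ a b) × ¬ (τ b c ≋ τ a c)
  triangle-≉ a b c abc@(a≢b , a≢c , b≢c) =
    τ-≉-shared a b c abc ,
    (λ p → τ-≉-shared b c a (b≢c , ≢-sym a≢b , ≢-sym a≢c) (≋-trans p (τ-comm a b))) ,
    (λ p → τ-≉-shared c b a (≢-sym b≢c , ≢-sym a≢c , ≢-sym a≢b) (≋-trans (τ-comm c b) (≋-trans p (τ-comm a c))))

  τ·τ-comm-disjoint : (a b c d : Fin n) → c ≢ a → c ≢ b → d ≢ a → d ≢ b → τ a b · τ c d ≋ τ c d · τ a b
  τ·τ-comm-disjoint a b c d c≢a c≢b d≢a d≢b = ·-cancelʳ (τ a b ⁻¹) (begin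
    τ a b · τ c d · τ a b ⁻¹          ≈⟨ conj-τ (τ a b) c d ⟩
    τ (ap (τ a b) c) (ap (τ a b) d)   ≈⟨ τ-cong (τ-fixes a b c c≢a c≢b) (τ-fixes a b d d≢a d≢b) ⟩
    τ c d                             ≈⟨ mk (λ i → cong (ap (τ c d)) (sym (P.inverseʳ (τ a b) {i}))) ⟩
    τ c d · τ a b · τ a b ⁻¹          ∎)
    where open SymReasoning

  τ·τ-rotate : (a b c : Fin n) → Distinct₃ a b c → τ a b · τ a c ≋ τ b c · τ a b
  τ·τ-rotate a b c (a≢b , a≢c , b≢c) = ·-cancelʳ (τ a b ⁻¹) (begin
    τ a b · τ a c · τ a b ⁻¹          ≈⟨ conj-τ (τ a b) a c ⟩
    τ (ap (τ a b) a) (ap (τ a b) c)   ≈⟨ τ-cong (τ-mapsˡ a b) (τ-fixes a b c (≢-sym a≢c) (≢-sym b≢c)) ⟩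
    τ b c                             ≈⟨ mk (λ i → cong (ap (τ b c)) (sym (P.inverseʳ (τ a b) {i}))) ⟩
    τ b c · τ a b · τ a b ⁻¹          ∎)
    where open SymReasoning

  CommonNbr : Sym n → Sym n → Sym n → Set
  CommonNbr s t r = Σ (Sym n) λ u → ¬ (u ≋ e) × Adjacent s u × Adjacent t u × Adjacent r u

  CommonNbr-cong : {s s′ t t′ r r′ : Sym n} → s ≋ s′ → t ≋ t′ → r ≋ r′ → CommonNbr s t r → CommonNbr s′ t′ r′
  CommonNbr-cong p q w (u , u≉e , a₁ , a₂ , a₃) =
    u , u≉e , Adjacent-cong p ≋-refl a₁ , Adjacent-cong q ≋-refl a₂ , Adjacent-cong w ≋-refl a₃

  τ·τ≉e : (a b c : Fin n) → Distinct₃ a b c → ¬ (τ a b · τ a c ≋ e)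
  τ·τ≉e a b c (a≢b , a≢c , b≢c) p =
    a≢c (sym (trans (sym (trans (cong (ap (τ a b)) (τ-mapsˡ a c)) (τ-fixes a b c (≢-sym a≢c) (≢-sym b≢c)))) (at p a)))

  triangle-commonNbr : (a b c : Fin n) → Distinct₃ a b c → CommonNbr (τ a b) (τ a c) (τ b c)
  triangle-commonNbr a b c abc@(a≢b , a≢c , b≢c) =
    τ a b · τ a c , τ·τ≉e a b c abc ,
    Adjacent-byʳ (τ a b) (τ-isTransp a≢c) ,
    Adjacent-by (τ a c) (τ-isTransp a≢b) ,
    Adjacent-cong ≋-refl (≋-sym (τ·τ-rotate a b c abc)) (Adjacent-byʳ (τ b c) (τ-isTransp a≢b))

  -- Besides e, disjoint s and t have the single common neighbour s t = t s,
  -- and the only transpositions adjacent to it are s and t.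
  commonNbr⇒shareMoved : {s t r : Sym n} → IsTransp s → IsTransp t → IsTransp r →
                         ¬ (s ≋ t) → ¬ (r ≋ s) → ¬ (r ≋ t) → CommonNbr s t r → ShareMoved s t
  commonNbr⇒shareMoved {s} {t} {r} ts tt tr s≉t r≉s r≉t (u , u≉e , a₁ , a₂ , adjacent q tq u≋qr)
    with IsTransp-pair ts tt
  ... | inj₁ s≋t = ⊥-elim (s≉t s≋t)
  ... | inj₂ (inj₁ (x , y , z , (x≢y , x≢z , _) , s≋ , t≋)) =
    x , Moves-cong (≋-sym s≋) (τ-movesˡ x y x≢y) , Moves-cong (≋-sym t≋) (τ-movesˡ x z x≢z)
  ... | inj₂ (inj₂ (a , b , c , d , _ , _ , a≢c , a≢d , b≢c , b≢d , s≋ , t≋)) =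
    ⊥-elim (excluded (IsTransp-factor ts tt s≉t tr tq (≋-trans (≋-sym u≋qr) u≋ts)))
    where
    st≋ts : s · t ≋ t · s
    st≋ts = ≋-trans (·-cong s≋ t≋) (≋-trans (τ·τ-comm-disjoint a b c d (≢-sym a≢c) (≢-sym b≢c) (≢-sym a≢d) (≢-sym b≢d))
                                   (≋-sym (·-cong t≋ s≋)))
    u≋ts : u ≋ t · s
    u≋ts with common-neighbours ts tt s≉t a₁ a₂
    ... | inj₁ u≋e = ⊥-elim (u≉e u≋e)
    ... | inj₂ (inj₁ u≋st) = ≋-trans u≋st st≋ts
    ... | inj₂ (inj₂ u≋ts′) = u≋ts′
    excluded : r ≋ s ⊎ r ≋ t ⊎ r ≋ s · t · s → ⊥
    excluded (inj₁ p) = r≉s p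
    excluded (inj₂ (inj₁ p)) = r≉t p
    excluded (inj₂ (inj₂ p)) = r≉t (≋-trans p (≋-trans (·-congˡ s st≋ts) (·-congʳ t (IsTransp-involutive ts))))

  star-no-commonNbr : {s₁ s₂ s₃ : Sym n} {x : Fin n} → IsTransp s₁ → IsTransp s₂ → IsTransp s₃ →
                      ¬ (s₁ ≋ s₂) → ¬ (s₃ ≋ s₁) → ¬ (s₃ ≋ s₂) →
                      Moves s₁ x → Moves s₂ x → Moves s₃ x → ¬ CommonNbr s₁ s₂ s₃
  star-no-commonNbr {s₁} {s₂} {s₃} {x} t₁ t₂ t₃ s₁≉s₂ s₃≉s₁ s₃≉s₂ m₁ m₂ m₃ (u , u≉e , a₁ , a₂ , adjacent q tq u≋qs₃) =
    u-moves-y u-fixes-y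
    where
    y = ap s₃ x
    s₃≋ : s₃ ≋ τ x y
    s₃≋ = IsTransp-moves t₃ m₃
    sᵢ-fixes-y : {sᵢ : Sym n} → IsTransp sᵢ → Moves sᵢ x → ¬ (s₃ ≋ sᵢ) → ap sᵢ y ≡ y
    sᵢ-fixes-y {sᵢ} tᵢ mᵢ s₃≉sᵢ =
      trans (at (IsTransp-moves tᵢ mᵢ) y)
            (τ-fixes x (ap sᵢ x) y m₃ λ r → s₃≉sᵢ (≋-trans s₃≋ (≋-trans (τ-cong refl r) (≋-sym (IsTransp-moves tᵢ mᵢ)))))
    u-moves-y : Moves u y
    u-moves-y = Moves-cong (≋-sym u≋qs₃)
      (Moves-· t₃ tq (λ r → u≉e (≋-trans u≋qs₃ r)) (Moves-cong (≋-sym s₃≋) (τ-movesʳ x y (≢-sym m₃))))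
    u-fixes-y : ap u y ≡ y
    u-fixes-y with common-neighbours t₁ t₂ s₁≉s₂ a₁ a₂
    ... | inj₁ u≋e = ⊥-elim (u≉e u≋e)
    ... | inj₂ (inj₁ u≋s₁s₂) = trans (at u≋s₁s₂ y) (trans (cong (ap s₁) (sᵢ-fixes-y t₂ m₂ s₃≉s₂)) (sᵢ-fixes-y t₁ m₁ s₃≉s₁))
    ... | inj₂ (inj₂ u≋s₂s₁) = trans (at u≋s₂s₁ y) (trans (cong (ap s₂) (sᵢ-fixes-y t₁ m₁ s₃≉s₁)) (sᵢ-fixes-y t₂ m₂ s₃≉s₂))

  shareMoved⇒commonNbr : {s₁ s₂ s₃ : Sym n} {x : Fin n} → IsTransp s₁ → IsTransp s₂ → IsTransp s₃ → ¬ (s₁ ≋ s₂) →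
                         Moves s₁ x → Moves s₂ x → ¬ Moves s₃ x →
                         ShareMoved s₁ s₃ → ShareMoved s₂ s₃ → CommonNbr s₁ s₂ s₃
  shareMoved⇒commonNbr {s₁} {s₂} {s₃} {x} t₁ t₂ t₃ s₁≉s₂ m₁ m₂ s₃-fixes =
    λ sh₁ sh₂ → CommonNbr-cong (≋-sym s₁≋) (≋-sym s₂≋)
                  (≋-sym (IsTransp-on t₃ (s₃-moves t₁ m₁ s₁≋ sh₁) (s₃-moves t₂ m₂ s₂≋ sh₂) y₁≢y₂))
                  (triangle-commonNbr x y₁ y₂ (≢-sym m₁ , ≢-sym m₂ , y₁≢y₂))
    where
    y₁ = ap s₁ x
    y₂ = ap s₂ x
    s₁≋ : s₁ ≋ τ x y₁
    s₁≋ = IsTransp-moves t₁ m₁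
    s₂≋ : s₂ ≋ τ x y₂
    s₂≋ = IsTransp-moves t₂ m₂
    y₁≢y₂ : y₁ ≢ y₂
    y₁≢y₂ r = s₁≉s₂ (≋-trans s₁≋ (≋-trans (τ-cong refl r) (≋-sym s₂≋)))
    s₃-moves : {sᵢ : Sym n} → IsTransp sᵢ → (mᵢ : Moves sᵢ x) → sᵢ ≋ τ x (ap sᵢ x) →
               ShareMoved sᵢ s₃ → Moves s₃ (ap sᵢ x)
    s₃-moves tᵢ mᵢ sᵢ≋ (w , mwᵢ , mw₃) with τ-moves⇒endpoint x _ w (Moves-cong sᵢ≋ mwᵢ)
    ... | inj₁ refl = ⊥-elim (s₃-fixes mw₃)
    ... | inj₂ refl = mw₃

module _ {n : ℕ} (φ : GraphAut n) (φ-e : GraphAut.to φ e ≋ e) where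

  open GraphAut using (to; from)

  to-IsTransp : {s : Sym n} → IsTransp s → IsTransp (to φ s)
  to-IsTransp t = Adjacent-e (Adjacent-cong φ-e ≋-refl (to-adjacent φ (Adjacent-by e t)))

  to-commonNbr : {s t r : Sym n} → CommonNbr s t r → CommonNbr (to φ s) (to φ t) (to φ r)
  to-commonNbr (u , u≉e , a₁ , a₂ , a₃) =
    to φ u , (λ p → u≉e (to-injective φ (≋-trans p (≋-sym φ-e)))) , to-adjacent φ a₁ , to-adjacent φ a₂ , to-adjacent φ a₃

  to-commonNbr⁻ : {s t r : Sym n} → CommonNbr (to φ s) (to φ t) (to φ r) → CommonNbr s t r
  to-commonNbr⁻ (w , w≉e , a₁ , a₂ , a₃) =
    from φ w , (λ p → w≉e (≋-trans (≋-sym (to-from φ w)) (≋-trans (to-cong φ p) φ-e))) ,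
    pull a₁ , pull a₂ , pull a₃
    where
    pull : ∀ {s} → Adjacent (to φ s) w → Adjacent s (from φ w)
    pull a = to-adjacent⁻ φ (Adjacent-cong ≋-refl (≋-sym (to-from φ w)) a)

module _ {m : ℕ} (f : Fin (suc m) → Fin (suc m)) (f-injective : Injective _≡_ _≡_ f) where

  private
    f-surjective : ∀ y → Σ (Fin (suc m)) λ x → f x ≡ y
    f-surjective y with any? (λ x → f x ≟ y)
    ... | yes hit = hit
    ... | no miss = ⊥-elim (1+n≰n (injective⇒≤ {f = squeeze} squeeze-injective))
      where
      squeeze : Fin (suc m) → Fin m
      squeeze x = punchOut {i = y} {j = f x} (λ r → miss (x , sym r))
      squeeze-injective : Injective _≡_ _≡_ squeeze
      squeeze-injective {x} {z} r = f-injective (punchOut-injective (λ r → miss (x , sym r)) (λ r → miss (z , sym r)) r)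

  fromInjection : Sym (suc m)
  fromInjection = P.permutation f (proj₁ ∘ f-surjective) (proj₂ ∘ f-surjective) (λ x → f-injective (proj₂ (f-surjective (f x))))

module _ {k : ℕ} where

  two-others : (a : Fin (3 + k)) → Σ (Fin (3 + k)) λ b → Σ (Fin (3 + k)) λ c → Distinct₃ a b c
  two-others a = punchIn a zero , punchIn a (suc zero) ,
                 (λ r → punchInᵢ≢i a zero (sym r)) , (λ r → punchInᵢ≢i a (suc zero) (sym r)) ,
                 (λ r → 0≢1 (punchIn-injective a zero (suc zero) r))
    where
    0≢1 : _≡_ {A = Fin (2 + k)} zero (suc zero) → ⊥
    0≢1 ()

  another : (a d : Fin (3 + k)) → Σ (Fin (3 + k)) λ c → a ≢ c × d ≢ c
  another a d with two-others a
  ... | b , c , a≢b , a≢c , b≢c with b ≟ d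
  ...   | yes refl = c , a≢c , b≢c
  ...   | no b≢d = b , a≢b , ≢-sym b≢d

module _ {k : ℕ} (ψ : GraphAut (3 + k)) (ψ-e : GraphAut.to ψ e ≋ e) where

  private
    ψτ : Fin (3 + k) → Fin (3 + k) → Sym (3 + k)
    ψτ a b = GraphAut.to ψ (τ a b)

    ψτ-IsTransp : {a b : Fin (3 + k)} → a ≢ b → IsTransp (ψτ a b)
    ψτ-IsTransp a≢b = to-IsTransp ψ ψ-e (τ-isTransp a≢b)

    ψτ-≉ : (a b c d : Fin (3 + k)) → ¬ (τ a b ≋ τ c d) → ¬ (ψτ a b ≋ ψτ c d)
    ψτ-≉ a b c d τ≉ p = τ≉ (to-injective ψ {τ a b} {τ c d} p)

    ψτ-triangle : (a b c : Fin (3 + k)) → Distinct₃ a b c → CommonNbr (ψτ a b) (ψτ a c) (ψτ b c)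
    ψτ-triangle a b c abc = to-commonNbr ψ ψ-e (triangle-commonNbr a b c abc)

    ψτ-triangle-not-star : (a b c : Fin (3 + k)) → Distinct₃ a b c → {x : Fin (3 + k)} →
                           Moves (ψτ a b) x → Moves (ψτ a c) x → Moves (ψτ b c) x → ⊥
    ψτ-triangle-not-star a b c abc@(a≢b , a≢c , b≢c) m₁ m₂ m₃ with triangle-≉ a b c abc
    ... | ≉₁ , ≉₂ , ≉₃ =
      star-no-commonNbr (ψτ-IsTransp a≢b) (ψτ-IsTransp a≢c) (ψτ-IsTransp b≢c) (ψτ-≉ a b a c ≉₁) (ψτ-≉ b c a b ≉₂) (ψτ-≉ b c a c ≉₃)
        m₁ m₂ m₃ (ψτ-triangle a b c abc)

    ψτ-shareMoved : (a b c : Fin (3 + k)) → Distinct₃ a b c → ShareMoved (ψτ a b) (ψτ a c)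
    ψτ-shareMoved a b c abc@(a≢b , a≢c , b≢c) with triangle-≉ a b c abc
    ... | ≉₁ , ≉₂ , ≉₃ = commonNbr⇒shareMoved (ψτ-IsTransp a≢b) (ψτ-IsTransp a≢c) (ψτ-IsTransp b≢c)
                            (ψτ-≉ a b a c ≉₁) (ψτ-≉ b c a b ≉₂) (ψτ-≉ b c a c ≉₃) (ψτ-triangle a b c abc)

    -- A star τ a b, τ a c, τ a d cannot be sent to a triangle.
    ψτ-star-moves : (a b c d : Fin (3 + k)) → Distinct₃ a b c → a ≢ d →
                    ((x , _) : ShareMoved (ψτ a b) (ψτ a c)) → Moves (ψτ a d) x
    ψτ-star-moves a b c d abc@(a≢b , a≢c , b≢c) a≢d (x , m₁ , m₂) with d ≟ b | d ≟ c
    ... | yes refl | _ = m₁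
    ... | no _ | yes refl = m₂
    ... | no d≢b | no d≢c = λ fixed →
      star-no-commonNbr {x = a} (τ-isTransp a≢b) (τ-isTransp a≢c) (τ-isTransp a≢d)
        (τ-≉-shared a b c abc) (τ-≉-shared a d b (a≢d , a≢b , d≢b)) (τ-≉-shared a d c (a≢d , a≢c , d≢c))
        (τ-movesˡ a b a≢b) (τ-movesˡ a c a≢c) (τ-movesˡ a d a≢d)
        (to-commonNbr⁻ ψ ψ-e
          (shareMoved⇒commonNbr (ψτ-IsTransp a≢b) (ψτ-IsTransp a≢c) (ψτ-IsTransp a≢d)
            (ψτ-≉ a b a c (τ-≉-shared a b c abc)) m₁ m₂ (λ m → m fixed)
            (ψτ-shareMoved a b d (a≢b , a≢d , ≢-sym d≢b)) (ψτ-shareMoved a c d (a≢c , a≢d , ≢-sym d≢c))))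

    centreOf : (a : Fin (3 + k)) → Σ (Fin (3 + k)) (λ b → Σ (Fin (3 + k)) λ c → Distinct₃ a b c) → Fin (3 + k)
    centreOf a (b , c , abc) = proj₁ (ψτ-shareMoved a b c abc)

    centreOf-moved : (a d : Fin (3 + k)) → a ≢ d → (bc : Σ (Fin (3 + k)) λ b → Σ (Fin (3 + k)) λ c → Distinct₃ a b c) →
                     Moves (ψτ a d) (centreOf a bc)
    centreOf-moved a d a≢d (b , c , abc) = ψτ-star-moves a b c d abc a≢d (ψτ-shareMoved a b c abc)

    -- The common point of the images of the transpositions through a.
    centre : Fin (3 + k) → Fin (3 + k)
    centre a = centreOf a (two-others a)

    centre-moved : (a d : Fin (3 + k)) → a ≢ d → Moves (ψτ a d) (centre a)
    centre-moved a d a≢d = centreOf-moved a d a≢d (two-others a)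

    centre-≢ : (a d : Fin (3 + k)) → a ≢ d → centre a ≢ centre d
    centre-≢ a d a≢d same = through (another a d)
      where
      through : (Σ (Fin (3 + k)) λ c → a ≢ c × d ≢ c) → ⊥
      through (c , a≢c , d≢c) = ψτ-triangle-not-star a d c (a≢d , a≢c , d≢c)
        (centre-moved a d a≢d) (centre-moved a c a≢c) (subst (Moves (ψτ d c)) (sym same) (centre-moved d c d≢c))

    centre-injective : Injective _≡_ _≡_ centre
    centre-injective {a} {d} same = decide (a ≟ d)
      where
      decide : Dec (a ≡ d) → a ≡ d
      decide (yes a≡d) = a≡d
      decide (no a≢d) = ⊥-elim (centre-≢ a d a≢d same)

  e-fixing⇒conj-on-transpositions : Σ (Sym (3 + k)) λ c → ∀ a b → a ≢ b → GraphAut.to ψ (τ a b) ≋ τ (ap c a) (ap c b)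
  e-fixing⇒conj-on-transpositions = fromInjection centre centre-injective , λ a b a≢b →
    IsTransp-on (ψτ-IsTransp a≢b) (centre-moved a b a≢b)
      (Moves-cong (to-cong ψ (τ-comm b a)) (centre-moved b a (≢-sym a≢b))) (centre-≢ a b a≢b)

module _ {n : ℕ} where

  open GraphAut using (to)

  ρ : Fin n → Fin n → Fin n → Sym n
  ρ a b c = τ a b · τ a c

  ρ≉ρ-swap : (a b c : Fin n) → Distinct₃ a b c → ¬ (ρ a b c ≋ ρ a c b)
  ρ≉ρ-swap a b c (a≢b , a≢c , b≢c) p = b≢c (sym (begin
    c                         ≡⟨ sym (τ-fixes a b c (≢-sym a≢c) (≢-sym b≢c)) ⟩
    ap (τ a b) c              ≡⟨ cong (ap (τ a b)) (sym (τ-mapsˡ a c)) ⟩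
    ap (ρ a b c) a            ≡⟨ at p a ⟩
    ap (τ a c) (ap (τ a b) a) ≡⟨ cong (ap (τ a c)) (τ-mapsˡ a b) ⟩
    ap (τ a c) b              ≡⟨ τ-fixes a c b (≢-sym a≢b) b≢c ⟩
    b                         ∎))
    where open ≡-Reasoning

  ρ-rotate : (a b c : Fin n) → Distinct₃ a b c → ρ a b c ≋ ρ b c a
  ρ-rotate a b c abc = ≋-trans (τ·τ-rotate a b c abc) (·-congʳ (τ b c) (τ-comm a b))

  FixesS : GraphAut n → Set
  FixesS θ = to θ e ≋ e × (∀ a b → a ≢ b → to θ (τ a b) ≋ τ a b)

  FixesCycle : GraphAut n → Fin n → Fin n → Fin n → Set
  FixesCycle θ a b c = to θ (ρ a b c) ≋ ρ a b c

  FixesS∪C₃ : GraphAut n → Set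
  FixesS∪C₃ θ = FixesS θ × (∀ a b c → Distinct₃ a b c → FixesCycle θ a b c)

  FixesS⇒product : (θ : GraphAut n) → FixesS θ → {s t : Sym n} → IsTransp s → IsTransp t → ¬ (s ≋ t) →
                   to θ (s · t) ≋ s · t ⊎ to θ (s · t) ≋ t · s
  FixesS⇒product θ (θ-e , θ-τ) {s} {t} ts tt s≉t =
    exclude-e (common-neighbours ts tt s≉t (fixed-adjacent ts (Adjacent-byʳ s tt)) (fixed-adjacent tt (Adjacent-by t ts)))
    where
    fixed-adjacent : ∀ {r} → IsTransp r → Adjacent r (s · t) → Adjacent r (to θ (s · t))
    fixed-adjacent (i , j , i≢j , r≋) a =
      Adjacent-cong (≋-trans (to-cong θ r≋) (≋-trans (θ-τ i j i≢j) (≋-sym r≋))) ≋-refl (to-adjacent θ a)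
    exclude-e : to θ (s · t) ≋ e ⊎ to θ (s · t) ≋ s · t ⊎ to θ (s · t) ≋ t · s →
                to θ (s · t) ≋ s · t ⊎ to θ (s · t) ≋ t · s
    exclude-e (inj₁ θst≋e) =
      ⊥-elim (·-IsTransp-≉e tt (λ p → s≉t (≋-sym p)) (to-injective θ (≋-trans θst≋e (≋-sym θ-e))))
    exclude-e (inj₂ r) = r

  FixesS⇒ρ-or-swap : (θ : GraphAut n) → FixesS θ → (a b c : Fin n) → Distinct₃ a b c →
                     FixesCycle θ a b c ⊎ to θ (ρ a b c) ≋ ρ a c b
  FixesS⇒ρ-or-swap θ fs a b c abc@(a≢b , a≢c , _) =
    FixesS⇒product θ fs (τ-isTransp a≢b) (τ-isTransp a≢c) (τ-≉-shared a b c abc)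

  FixesCycle-swap : (θ : GraphAut n) → FixesS θ → (a b c : Fin n) → Distinct₃ a b c →
                    FixesCycle θ a b c → FixesCycle θ a c b
  FixesCycle-swap θ fs a b c abc fixed = exclude (FixesS⇒ρ-or-swap θ fs a c b (Distinct₃-swap abc))
    where
    exclude : FixesCycle θ a c b ⊎ to θ (ρ a c b) ≋ ρ a b c → FixesCycle θ a c b
    exclude (inj₁ fixed′) = fixed′
    exclude (inj₂ swapped) =
      ⊥-elim (ρ≉ρ-swap a b c abc (≋-sym (to-injective θ {ρ a c b} {ρ a b c} (≋-trans swapped (≋-sym fixed)))))

  FixesCycle-swapped : (θ : GraphAut n) → FixesS θ → (a b c : Fin n) → Distinct₃ a b c →
                       to θ (ρ a b c) ≋ ρ a c b → to θ (ρ a c b) ≋ ρ a b c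
  FixesCycle-swapped θ fs a b c abc swapped = exclude (FixesS⇒ρ-or-swap θ fs a c b (Distinct₃-swap abc))
    where
    exclude : FixesCycle θ a c b ⊎ to θ (ρ a c b) ≋ ρ a b c → to θ (ρ a c b) ≋ ρ a b c
    exclude (inj₁ fixed) =
      ⊥-elim (ρ≉ρ-swap a b c abc (to-injective θ {ρ a b c} {ρ a c b} (≋-trans swapped (≋-sym fixed))))
    exclude (inj₂ swapped′) = swapped′

  FixesCycle-rotate : (θ : GraphAut n) (a b c : Fin n) → Distinct₃ a b c → FixesCycle θ a b c → FixesCycle θ b c a
  FixesCycle-rotate θ a b c abc fixed =
    ≋-trans (to-cong θ (≋-sym (ρ-rotate a b c abc))) (≋-trans fixed (ρ-rotate a b c abc))

  FixesS⇒fixes-disjoint : (θ : GraphAut n) → FixesS θ → (a b c d : Fin n) → a ≢ b → c ≢ d →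
                          a ≢ c → a ≢ d → b ≢ c → b ≢ d → to θ (τ c d · τ a b) ≋ τ c d · τ a b
  FixesS⇒fixes-disjoint θ fs a b c d a≢b c≢d a≢c a≢d b≢c b≢d =
    commute (FixesS⇒product θ fs (τ-isTransp c≢d) (τ-isTransp a≢b) (τ-≉ c d a b c≢d (≢-sym a≢c) (≢-sym b≢c)))
    where
    commute : to θ (τ c d · τ a b) ≋ τ c d · τ a b ⊎ to θ (τ c d · τ a b) ≋ τ a b · τ c d →
              to θ (τ c d · τ a b) ≋ τ c d · τ a b
    commute (inj₁ fixed) = fixed
    commute (inj₂ swapped) =
      ≋-trans swapped (τ·τ-comm-disjoint a b c d (≢-sym a≢c) (≢-sym b≢c) (≢-sym a≢d) (≢-sym b≢d))

  disjoint-not-shareMoved : (a b c d : Fin n) → a ≢ b → a ≢ d → c ≢ b → c ≢ d → ¬ ShareMoved (τ a c) (τ b d)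
  disjoint-not-shareMoved a b c d a≢b a≢d c≢b c≢d (x , m₁ , m₂)
    with τ-moves⇒endpoint a c x m₁ | τ-moves⇒endpoint b d x m₂
  ... | inj₁ refl | inj₁ refl = a≢b refl
  ... | inj₁ refl | inj₂ refl = a≢d refl
  ... | inj₂ refl | inj₁ refl = c≢b refl
  ... | inj₂ refl | inj₂ refl = c≢d refl

  -- If θ swapped ρ a d b, then θ conjugated by R(τ a b) would map the triangle
  -- τ a c, τ a d, τ c d onto τ a c, τ b d, τ c d, which is not a triangle.
  FixesCycle-replace : (θ : GraphAut n) → FixesS θ → (a b c d : Fin n) → Distinct₃ a b c →
                       d ≢ a → d ≢ b → d ≢ c → FixesCycle θ a b c → FixesCycle θ a b d
  FixesCycle-replace θ fs@(θ-e , θ-τ) a b c d abc@(a≢b , a≢c , b≢c) d≢a d≢b d≢c fixed =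
    decide (FixesS⇒ρ-or-swap θ fs a d b adb)
    where
    adb : Distinct₃ a d b
    adb = ≢-sym d≢a , a≢b , d≢b
    θ′ : GraphAut n
    θ′ = conjR θ (τ a b)
    θ′-e : to θ′ e ≋ e
    θ′-e = conjR-fixes θ (τ a b) e (θ-τ a b a≢b)
    θ′-ac : to θ′ (τ a c) ≋ τ a c
    θ′-ac = conjR-fixes θ (τ a b) (τ a c) (FixesCycle-swap θ fs a b c abc fixed)
    θ′-cd : to θ′ (τ c d) ≋ τ c d
    θ′-cd = conjR-fixes θ (τ a b) (τ c d)
      (FixesS⇒fixes-disjoint θ fs a b c d a≢b (≢-sym d≢c) a≢c (≢-sym d≢a) b≢c (≢-sym d≢b))
    decide : FixesCycle θ a d b ⊎ to θ (ρ a d b) ≋ ρ a b d → FixesCycle θ a b d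
    decide (inj₁ fixed′) = FixesCycle-swap θ fs a d b adb fixed′
    decide (inj₂ swapped) = ⊥-elim (disjoint-not-shareMoved a b c d a≢b (≢-sym d≢a) (≢-sym b≢c) (≢-sym d≢c)
      (commonNbr⇒shareMoved (τ-isTransp a≢c) (τ-isTransp (≢-sym d≢b)) (τ-isTransp (≢-sym d≢c))
        (τ-≉ a c b d a≢c a≢b (≢-sym d≢a))
        (λ p → τ-≉ d c a c d≢c d≢a d≢c (≋-trans (τ-comm d c) p))
        (λ p → τ-≉ c d b d (≢-sym d≢c) (≢-sym b≢c) (≢-sym d≢c) p)
        (CommonNbr-cong θ′-ac θ′-ad θ′-cd
          (to-commonNbr θ′ θ′-e (triangle-commonNbr a c d (a≢c , ≢-sym d≢a , ≢-sym d≢c))))))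
      where
      θ′-ad : to θ′ (τ a d) ≋ τ b d
      θ′-ad = ≋-trans (·-congˡ (τ a b ⁻¹) swapped)
                      (≋-trans (conj-τ (τ a b) a d) (τ-cong (τ-mapsˡ a b) (τ-fixes a b d d≢a d≢b)))

  FixesCycle-set₃ : (θ : GraphAut n) → FixesS θ → (a b c d : Fin n) → Distinct₃ a b c →
                    d ≢ a → d ≢ b → FixesCycle θ a b c → FixesCycle θ a b d
  FixesCycle-set₃ θ fs a b c d abc d≢a d≢b fixed = decide (d ≟ c)
    where
    decide : Dec (d ≡ c) → FixesCycle θ a b d
    decide (yes refl) = fixed
    decide (no d≢c) = FixesCycle-replace θ fs a b c d abc d≢a d≢b d≢c fixed

  private
    FixedCycleFrom : GraphAut n → Fin n → Set
    FixedCycleFrom θ a = Σ (Fin n) λ x → Σ (Fin n) λ y → Distinct₃ a x y × FixesCycle θ a x y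

    FixedCycleFrom₂ : GraphAut n → Fin n → Fin n → Set
    FixedCycleFrom₂ θ a b = Σ (Fin n) λ w → Distinct₃ a b w × FixesCycle θ a b w

    set₁ : (θ : GraphAut n) → FixesS θ → (p q r : Fin n) → Distinct₃ p q r → FixesCycle θ p q r →
           ∀ a → FixedCycleFrom θ a
    set₁ θ fs p q r pqr@(p≢q , p≢r , q≢r) fixed a = decide (a ≟ p) (a ≟ q)
      where
      decide : Dec (a ≡ p) → Dec (a ≡ q) → FixedCycleFrom θ a
      decide (yes refl) _ = q , r , pqr , fixed
      decide (no _) (yes refl) = r , p , Distinct₃-rotate pqr , FixesCycle-rotate θ p q r pqr fixed
      decide (no a≢p) (no a≢q) = p , q , Distinct₃-rotate (Distinct₃-rotate pqa) ,
        FixesCycle-rotate θ q a p (Distinct₃-rotate pqa)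
          (FixesCycle-rotate θ p q a pqa (FixesCycle-set₃ θ fs p q r a pqr a≢p a≢q fixed))
        where
        pqa : Distinct₃ p q a
        pqa = p≢q , ≢-sym a≢p , ≢-sym a≢q

    set₂ : (θ : GraphAut n) → FixesS θ → (a x y b : Fin n) → Distinct₃ a x y → a ≢ b → FixesCycle θ a x y →
           FixedCycleFrom₂ θ a b
    set₂ θ fs a x y b axy@(a≢x , a≢y , x≢y) a≢b fixed = decide (b ≟ x)
      where
      decide : Dec (b ≡ x) → FixedCycleFrom₂ θ a b
      decide (yes refl) = y , axy , fixed
      decide (no b≢x) = x , Distinct₃-swap axb ,
        FixesCycle-swap θ fs a x b axb (FixesCycle-set₃ θ fs a x y b axy (≢-sym a≢b) b≢x fixed)
        where
        axb : Distinct₃ a x b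
        axb = a≢x , a≢b , ≢-sym b≢x

  FixesCycle-all : (θ : GraphAut n) → FixesS θ → (p q r : Fin n) → Distinct₃ p q r → FixesCycle θ p q r →
                   ∀ a b c → Distinct₃ a b c → FixesCycle θ a b c
  FixesCycle-all θ fs p q r pqr fixed a b c (a≢b , a≢c , b≢c) with set₁ θ fs p q r pqr fixed a
  ... | x , y , axy , fixed₁ with set₂ θ fs a x y b axy a≢b fixed₁
  ...   | w , abw , fixed₂ = FixesCycle-set₃ θ fs a b w c abw (≢-sym a≢c) (≢-sym b≢c) fixed₂

  FixesS∪C₃⇒fixes-product : (θ : GraphAut n) → FixesS∪C₃ θ → {s t : Sym n} → IsTransp s → IsTransp t →
                            to θ (s · t) ≋ s · t
  FixesS∪C₃⇒fixes-product θ (fs@(θ-e , _) , θ-ρ) {s} {t} ts tt = by-shape (IsTransp-pair ts tt)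
    where
    by-shape : s ≋ t ⊎ Overlapping s t ⊎ Disjoint s t → to θ (s · t) ≋ s · t
    by-shape (inj₁ s≋t) = ≋-trans (to-cong θ st≋e) (≋-trans θ-e (≋-sym st≋e))
      where
      st≋e : s · t ≋ e
      st≋e = ≋-trans (·-congʳ s (≋-sym s≋t)) (IsTransp-involutive ts)
    by-shape (inj₂ (inj₁ (x , y , z , xyz , s≋ , t≋))) =
      ≋-trans (to-cong θ (·-cong s≋ t≋)) (≋-trans (θ-ρ x y z xyz) (≋-sym (·-cong s≋ t≋)))
    by-shape (inj₂ (inj₂ (a , b , c , d , a≢b , c≢d , a≢c , a≢d , b≢c , b≢d , s≋ , t≋))) =
      ≋-trans (to-cong θ (·-cong s≋ t≋))
        (≋-trans (FixesS⇒fixes-disjoint θ fs c d a b c≢d a≢b (≢-sym a≢c) (≢-sym b≢c) (≢-sym a≢d) (≢-sym b≢d))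
                 (≋-sym (·-cong s≋ t≋)))

  FixesS∪C₃-cong : (θ θ′ : GraphAut n) → (∀ u → to θ u ≋ to θ′ u) → FixesS∪C₃ θ → FixesS∪C₃ θ′
  FixesS∪C₃-cong θ θ′ θ≋θ′ ((θ-e , θ-τ) , θ-ρ) =
    (≋-trans (≋-sym (θ≋θ′ e)) θ-e , λ a b a≢b → ≋-trans (≋-sym (θ≋θ′ (τ a b))) (θ-τ a b a≢b)) ,
    λ a b c abc → ≋-trans (≋-sym (θ≋θ′ (ρ a b c))) (θ-ρ a b c abc)

  FixesS∪C₃-conjR-τ : (θ : GraphAut n) → FixesS∪C₃ θ → (a b c : Fin n) → Distinct₃ a c b →
                      FixesS∪C₃ (conjR θ (τ a b))
  FixesS∪C₃-conjR-τ θ fixes@((_ , θ-τ) , _) a b c acb@(a≢c , a≢b , _) =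
    fs′ , FixesCycle-all (conjR θ t) fs′ a c b acb fixes-ρacb
    where
    t : Sym n
    t = τ a b
    fs′ : FixesS (conjR θ t)
    fs′ = conjR-fixes θ t e (θ-τ a b a≢b) ,
          λ x y x≢y → conjR-fixes θ t (τ x y) (FixesS∪C₃⇒fixes-product θ fixes (τ-isTransp x≢y) (τ-isTransp a≢b))
    -- ρ a c b · τ a b = τ a c
    fixes-ρacb : FixesCycle (conjR θ t) a c b
    fixes-ρacb = ≋-trans (·-congˡ (t ⁻¹) (≋-trans (to-cong θ (·-congʳ (τ a c) (τ-involutive a b))) (θ-τ a c a≢c)))
                         (·-congʳ (τ a c) (IsTransp-inverse (τ-isTransp a≢b)))

-- Transpositions generate Sym n: sort x by fixing its points from the top down.
module _ {n : ℕ} (Good : GraphAut n → Set)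
         (Good-cong : ∀ θ θ′ → (∀ u → GraphAut.to θ u ≋ GraphAut.to θ′ u) → Good θ → Good θ′)
         (Good-conjR-τ : ∀ θ → Good θ → ∀ a b → a ≢ b → Good (conjR θ (τ a b))) where

  private
    FixesFrom : ℕ → Sym n → Set
    FixesFrom j x = ∀ i → j ≤ toℕ i → ap x i ≡ i

    below-or-at : (j : ℕ) (j<n : j < n) (i : Fin n) → j ≤ toℕ i → i ≡ fromℕ< j<n ⊎ suc j ≤ toℕ i
    below-or-at j j<n i j≤i with m≤n⇒m<n∨m≡n j≤i
    ... | inj₁ j<i = inj₂ j<i
    ... | inj₂ j≡i = inj₁ (toℕ-injective (trans (sym j≡i) (sym (toℕ-fromℕ< j<n))))

    Good-conjR-from : ∀ θ → Good θ → (j : ℕ) (x : Sym n) → FixesFrom j x → Good (conjR θ x)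
    Good-conjR-from θ good zero x fixes = Good-cong θ (conjR θ x)
      (λ u → ≋-sym (≋-trans (conjR-cong θ {x} {e} (mk λ i → fixes i z≤n) u) (conjR-e θ u))) good
    Good-conjR-from θ good (suc j) x fixes = by-bound (j <? n)
      where
      by-bound : Dec (j < n) → Good (conjR θ x)
      by-bound (no j≮n) = Good-conjR-from θ good j x λ i j≤i → ⊥-elim (j≮n (≤-<-trans j≤i (toℕ<n i)))
      by-bound (yes j<n) = by-pivot (ap x i₀ ≟ i₀)
        where
        i₀ : Fin n
        i₀ = fromℕ< j<n
        i₀-bound : ∀ {i} → suc j ≤ toℕ i → i ≢ i₀
        i₀-bound {i} j<i refl = ≤⇒≯ (subst (suc j ≤_) (toℕ-fromℕ< j<n) j<i) (s≤s ≤-refl)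
        by-pivot : Dec (ap x i₀ ≡ i₀) → Good (conjR θ x)
        by-pivot (yes fixed) = Good-conjR-from θ good j x λ i j≤i → extend (below-or-at j j<n i j≤i)
          where
          extend : ∀ {i} → i ≡ i₀ ⊎ suc j ≤ toℕ i → ap x i ≡ i
          extend (inj₁ refl) = fixed
          extend (inj₂ j<i) = fixes _ j<i
        by-pivot (no moved) = Good-cong (conjR (conjR θ x′) (τ i₀ j₀)) (conjR θ x)
            (λ u → ≋-trans (conjR-∘ θ x′ t u) (conjR-cong θ (≋-sym x≋tx′) u))
            (Good-conjR-τ (conjR θ x′) (Good-conjR-from θ good j x′ λ i j≤i → extend (below-or-at j j<n i j≤i))
                          i₀ j₀ (≢-sym moved))
          where
          j₀ : Fin n
          j₀ = ap x i₀
          t : Sym n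
          t = τ i₀ j₀
          x′ : Sym n
          x′ = t · x
          x≋tx′ : x ≋ t · x′
          x≋tx′ = mk λ i → sym (at (τ-involutive i₀ j₀) (ap x i))
          extend : ∀ {i} → i ≡ i₀ ⊎ suc j ≤ toℕ i → ap x′ i ≡ i
          extend (inj₁ refl) = τ-mapsʳ i₀ j₀
          extend (inj₂ j<i) = trans (cong (ap t) (fixes _ j<i))
            (τ-fixes i₀ j₀ _ (i₀-bound j<i) λ q → i₀-bound j<i (ap-injective x (trans (fixes _ j<i) q)))

  Good-conjR : ∀ θ → Good θ → (x : Sym n) → Good (conjR θ x)
  Good-conjR θ good x = Good-conjR-from θ good n x λ i n≤i → ⊥-elim (≤⇒≯ n≤i (toℕ<n i))

module _ {k : ℕ} where

  open GraphAut using (to)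

  private
    0F 1F 2F : Fin (3 + k)
    0F = zero
    1F = suc zero
    2F = suc (suc zero)

    012-distinct : Distinct₃ 0F 1F 2F
    012-distinct = (λ ()) , (λ ()) , (λ ())

  FixesS∪C₃⇒identity : (θ : GraphAut (3 + k)) → FixesS∪C₃ θ → ∀ x → to θ x ≋ x
  FixesS∪C₃⇒identity θ fixes x = ·-cancelʳ (x ⁻¹) (≋-trans θx·x⁻¹≋e (≋-sym (·-inverseʳ x)))
    where
    closed : ∀ θ′ → FixesS∪C₃ θ′ → ∀ a b → a ≢ b → FixesS∪C₃ (conjR θ′ (τ a b))
    closed θ′ fixes′ a b a≢b with another a b
    ... | c , a≢c , b≢c = FixesS∪C₃-conjR-τ θ′ fixes′ a b c (a≢c , a≢b , ≢-sym b≢c)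
    θx·x⁻¹≋e : to θ x · x ⁻¹ ≋ e
    θx·x⁻¹≋e = proj₁ (proj₁ (Good-conjR FixesS∪C₃ FixesS∪C₃-cong closed θ fixes x))

  -- θ ∘ h fixes e and S as well; it fixes ρ 0 1 2 when θ swaps it with its inverse ρ 0 2 1.
  FixesS⇒hPow : (θ : GraphAut (3 + k)) → FixesS θ → Σ Bool λ ε → ∀ x → to θ x ≋ hPow ε x
  FixesS⇒hPow θ fs@(θ-e , θ-τ) = by-cycle (FixesS⇒ρ-or-swap θ fs 0F 1F 2F 012-distinct)
    where
    identity-on : FixesCycle θ 0F 1F 2F → ∀ x → to θ x ≋ x
    identity-on fixed = FixesS∪C₃⇒identity θ (fs , FixesCycle-all θ fs 0F 1F 2F 012-distinct fixed)
    θh : GraphAut (3 + k)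
    θh = θ ∘ᴬ hInvAut
    θh-fs : FixesS θh
    θh-fs = θ-e , λ a b a≢b → ≋-trans (to-cong θ (IsTransp-inverse (τ-isTransp a≢b))) (θ-τ a b a≢b)
    ρ012⁻¹ : ρ 0F 1F 2F ⁻¹ ≋ ρ 0F 2F 1F
    ρ012⁻¹ = ·-cong (IsTransp-inverse (τ-isTransp {j = 2F} (λ ()))) (IsTransp-inverse (τ-isTransp {j = 1F} (λ ())))
    by-cycle : FixesCycle θ 0F 1F 2F ⊎ to θ (ρ 0F 1F 2F) ≋ ρ 0F 2F 1F → Σ Bool λ ε → ∀ x → to θ x ≋ hPow ε x
    by-cycle (inj₁ fixed) = false , identity-on fixed
    by-cycle (inj₂ swapped) =
      true , λ x → FixesS∪C₃⇒identity θh (θh-fs , FixesCycle-all θh θh-fs 0F 1F 2F 012-distinct θh-fixed) (x ⁻¹)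
      where
      θh-fixed : FixesCycle θh 0F 1F 2F
      θh-fixed = ≋-trans (to-cong θ ρ012⁻¹) (FixesCycle-swapped θ fs 0F 1F 2F 012-distinct swapped)

  GraphAut-standard : (φ : GraphAut (3 + k)) → Σ (Sym (3 + k)) λ g → Σ (Sym (3 + k)) λ c → Σ Bool λ ε →
                      to φ ≗ₛ stdMap g c ε
  GraphAut-standard φ = via-conjugator (e-fixing⇒conj-on-transpositions ψ ψ-e)
    where
    g : Sym (3 + k)
    g = to φ e
    ψ : GraphAut (3 + k)
    ψ = rightMulAut (g ⁻¹) ∘ᴬ φ
    ψ-e : to ψ e ≋ e
    ψ-e = ·-inverseʳ g
    via-conjugator : (Σ (Sym (3 + k)) λ c → ∀ a b → a ≢ b → to ψ (τ a b) ≋ τ (ap c a) (ap c b)) →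
                     Σ (Sym (3 + k)) λ g → Σ (Sym (3 + k)) λ c → Σ Bool λ ε → to φ ≗ₛ stdMap g c ε
    via-conjugator (c , ψ-τ) = via-hPow (FixesS⇒hPow χ χ-fs)
      where
      χ : GraphAut (3 + k)
      χ = innAut (c ⁻¹) ∘ᴬ ψ
      χ-fs : FixesS χ
      χ-fs = ≋-trans (inn-cong (c ⁻¹) ψ-e) (·-inverseˡ c) , λ a b a≢b →
        ≋-trans (inn-cong (c ⁻¹) (ψ-τ a b a≢b))
                (≋-trans (conj-τ (c ⁻¹) (ap c a) (ap c b)) (τ-cong (P.inverseˡ c) (P.inverseˡ c)))
      via-hPow : (Σ Bool λ ε → ∀ x → to χ x ≋ hPow ε x) →
                 Σ (Sym (3 + k)) λ g → Σ (Sym (3 + k)) λ c → Σ Bool λ ε → to φ ≗ₛ stdMap g c ε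
      via-hPow (ε , χ≋hPow) = g , c , ε , λ x → at (stdMap-solve c g (to φ x) (hPow ε x) (χ≋hPow x))

mainTheorem1 : (n : ℕ) → n ≥ 3 →
    -- every automorphism of Cay(S_n,S) lies in (R(S_n) ⋊ Inn(S_n)) ⋊ ⟨h⟩
    ((φ : GraphAut n) → Σ (Sym n) λ g → Σ (Sym n) λ c → Σ Bool λ ε →
        GraphAut.to φ ≗ₛ stdMap g c ε)
    -- every element of (R(S_n) ⋊ Inn(S_n)) ⋊ ⟨h⟩ is an automorphism
    × ((g c : Sym n) (ε : Bool) → Σ (GraphAut n) λ φ → GraphAut.to φ ≗ₛ stdMap g c ε)
    -- the decomposition R(g) ∘ inn(c) ∘ h^ε is unique (R ∩ Inn = 1, h ∉ R Inn)
    × ((g c g′ c′ : Sym n) (ε ε′ : Bool) → stdMap g c ε ≗ₛ stdMap g′ c′ ε′ →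
        (g ≈ g′) × (inn c ≗ₛ inn c′) × (ε ≡ ε′))
    -- Inn(S_n) normalises R(S_n)
    × ((c g : Sym n) → Σ (Sym n) λ g′ → (inn c ∘ rightMul g ∘ inn (c ⁻¹)) ≗ₛ rightMul g′)
    -- h normalises R(S_n) Inn(S_n)
    × ((g c : Sym n) → Σ (Sym n) λ g′ → Σ (Sym n) λ c′ →
        (hInv ∘ stdMap g c false ∘ hInv) ≗ₛ stdMap g′ c′ false)
    -- Cay(S_n,S) is not normal: R(S_n) is not normal in Aut(Cay(S_n,S))
    × ¬ ((φ : GraphAut n) (g : Sym n) → Σ (Sym n) λ g′ →
        (GraphAut.to φ ∘ rightMul g ∘ GraphAut.from φ) ≗ₛ rightMul g′)
mainTheorem1 (suc (suc (suc k))) (s≤s (s≤s (s≤s z≤n))) =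
  GraphAut-standard ,
  (λ g c ε → stdAut g c ε , stdAut-to g c ε) ,
  stdMap-unique ,
  (λ c g → inn c g , inn-normalises-R c g) ,
  (λ g c → g ⁻¹ , g ⁻¹ · c , hInv-normalises-RInn g c) ,
  R-not-normal
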